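{- Let $k\ge1$ and let $L=c_1H_1+\dots+c_mH_m\in\Gamma_k$ be a linear combination of $k$-vertex-labelled graphs all with the same vertex set $V=\bigsqcup_{i=1}^kV_i$, with $L\in\operatorname{Ker}(X_k)$, and let $S\subseteq S_{V_1}\times\dots\times S_{V_k}$ be a sufficient permutation set for $L$. Suppose $H^*$ is a $(k+1)$-vertex-labelled graph that is an augmentation of the $H_i$, with $V(H^*)=V\sqcup V_{k+1}$, and suppose that for every $\sigma\in S$ we have $H^*=H^*_{\sigma'}$ as labelled graphs, where $\sigma'$ is the permutation of $V(H^*)$ that agrees with $\sigma$ on $V$ and is the identity on $V_{k+1}$. Then $\mathbf{Lift}(L;H^*)\in\operatorname{Ker}(X_{k+1})$.
   Context: For $k\ge1$: for $i\ge1$, $1\le j\le k$ let $(x_i)_j$ be commuting indeterminates, $x_i^\alpha=\prod_j((x_i)_j)^{\alpha_j}$; $\Lambda_k$ is the $\mathbb{C}$-vector space of bounded-degree formal power series in the $(x_i)_j$ invariant under $(x_i)_j\mapsto(x_{\sigma(i)})_j$ (all $j$ simultaneously) for each permutation $\sigma$ of the positive integers. $\epsilon_i$ is the $i$-th unit vector of $\mathbb{Z}_{\ge0}^k$. A $k$-vertex-labelled graph is a finite graph (multiple edges allowed) with vertex set $\{(i,j):1\le i\le k,1\le j\le\alpha_i\}$ for some $\alpha\in\mathbb{Z}_{\ge0}^k$, vertex $(i,j)$ having weight $\epsilon_i$; $V_i=\{(i,j)\}_j$. $\Gamma_k$ is the $\mathbb{C}$-vector space of formal linear combinations of $k$-vertex-labelled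 graphs; $X_k:\Gamma_k\to\Lambda_k$ is linear with $X_k(G)=\sum_\kappa\prod_v x_{\kappa(v)}^{w(v)}$ over proper colorings $\kappa:V(G)\to\mathbb{Z}_{>0}$. For $G$ a $k$-vertex-labelled graph and $\sigma\in S_{V_1}\times\dots\times S_{V_k}$, $G_\sigma$ has the same vertex set and edge multiset $\{\sigma(u)\sigma(v):uv\in E(G)\}$, and $\ell_{iso}(G,\sigma)=G-G_\sigma$; $T_{iso}(k)$ is the set of all $\ell_{iso}(G,\sigma)$. For $L'=\sum c_iH'_i$ with common vertex set $U$ and a graph $G$ with $V(G)\supseteq U$, $\mathrm{Ext}(L';G)=\sum c_i(G\uplus E(H'_i))$, where $G\uplus E(H)$ has vertex set $V(G)$ and edge multiset the multiset union of $E(G)$ and $E(H)$. For $t=(m,n,p)\in\{1,\dots,k\}^3$ let $a_t=(m,1)$, $b_t=(n,1+\delta_{mn})$, $c_t=(p,1+\delta_{mp}+\delta_{np})$, $H_t$ the triangle on $\{a_t,b_t,c_t\}$, $\ell_{os(t)}=H_t-H_t\setminus\{a_tb_t\}-H_t\setminus\{a_tc_t\}+H_t\setminus\{a_tb_t,a_tc_t\}$; $T_{os}(k)$ is the set of all $\mathrm{Ext}(\ell_{os(t)};G)$ with $G$ a $k$-vertex-labelled graph with $V(G)\supseteq\{a_t,b_t,c_t\}$. A kernel-form presentation of $L$ is an expression $L=I+O$ with $I\in\operatorname{span}(T_{iso}(k))$, $O\in\operatorname{span}(T_{os}(k))$. A set $S\subseteq S_{V_1}\times\dots\times S_{V_k}$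 is a sufficient permutation set for $L$ if there is a kernel-form presentation $L=I+O$ with $I\in\operatorname{span}\{\ell_{iso}(G,\sigma): G\text{ a }k\text{ -vertex-labelled graph with }V(G)=V,\ \sigma\in S\}$. An augmentation of a $k$-vertex-labelled graph $H$ with vertex set $V$ is a $(k+1)$-vertex-labelled graph $H^*$ with $V(H^*)=V\sqcup V_{k+1}$, where the vertices of $V_{k+1}$ have weight $\epsilon_{k+1}$ and those of $V$ keep their weights. $\mathbf{Lift}(H;H^*)=H^*\uplus E(H)$, extended linearly: $\mathbf{Lift}(\sum c_iH_i;H^*)=\sum c_i(H^*\uplus E(H_i))\in\Gamma_{k+1}$. -}

module Defs where

open import Level using (Level; _⊔_)
open import Data.Nat as ℕ using (ℕ; zero; suc; _<_; _<?_)
open import Data.Fin as Fin using (Fin; toℕ; fromℕ<; inject₁)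
open import Data.Fin.Properties as FinP using (all?)
open import Data.Fin.Permutation using (Permutation′; _⟨$⟩ʳ_)
open import Data.Product using (Σ; _×_; _,_; proj₁; proj₂)
open import Data.Product.Properties using () renaming (≡-dec to ×-≡-dec)
open import Data.Sum using (_⊎_)
open import Data.Maybe using (Maybe; just; nothing)
open import Data.Maybe.Properties using () renaming (≡-dec to maybe-≡-dec)
open import Data.List using (List; []; _∷_; _++_; map; concatMap; upTo; allFin; filter; length; zip; foldr)
open import Data.List.Relation.Unary.All as All using (All)
open import Relation.Nullary using (Dec; yes; no; ¬_)
open import Relation.Nullary.Decidable using (_×-dec_; _⊎-dec_; ¬?)
open import Relation.Binary.PropositionalEquality using (_≡_; _≢_)
open import Algebra.Bundles using (CommutativeRing)

-- k-vertex-labelled (multi)graphs.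
-- Labels are Fin k (label i+1 of the paper is Fin value i); the vertex
-- (i , j) of the paper (1 ≤ j ≤ α_i) is the raw pair (i , j-1).

Vtx : ℕ → Set
Vtx k = Fin k × ℕ

_≟V_ : ∀ {k} (u v : Vtx k) → Dec (u ≡ v)
_≟V_ = ×-≡-dec Fin._≟_ ℕ._≟_

Edge : ℕ → Set
Edge k = Vtx k × Vtx k

-- A graph: the vertex-count vector α (vertex set {(i,j) : j < α i})
-- and the multiset of edges, given as a list (order and orientation
-- of the pairs are irrelevant; see SameGraph).
record Graph (k : ℕ) : Set where
  constructor graph
  field
    size  : Fin k → ℕ
    edges : List (Edge k)
open Graph public

InRange : ∀ {k} → (Fin k → ℕ) → Vtx k → Set
InRange α (i , j) = j < α i

WF : ∀ {k} → Graph k → Set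
WF G = All (λ e → InRange (size G) (proj₁ e) × InRange (size G) (proj₂ e) × proj₁ e ≢ proj₂ e) (edges G)

verts : ∀ {k} → (Fin k → ℕ) → List (Vtx k)
verts {k} α = concatMap (λ i → map (λ j → (i , j)) (upTo (α i))) (allFin k)

countE : ∀ {k} → Vtx k → Vtx k → List (Edge k) → ℕ
countE u v es = length (filter (λ e → ((proj₁ e ≟V u) ×-dec (proj₂ e ≟V v)) ⊎-dec ((proj₁ e ≟V v) ×-dec (proj₂ e ≟V u))) es)

SameGraph : ∀ {k} → Graph k → Graph k → Set
SameGraph G H = (∀ i → size G i ≡ size H i)
  × All (λ u → All (λ v → countE u v (edges G) ≡ countE u v (edges H)) (verts (size G))) (verts (size G))

sameGraph? : ∀ {k} (G H : Graph k) → Dec (SameGraph G H)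
sameGraph? G H = all? (λ i → size G i ℕ.≟ size H i)
  ×-dec All.all? (λ u → All.all? (λ v → countE u v (edges G) ℕ.≟ countE u v (edges H)) (verts (size G))) (verts (size G))

PermOf : ∀ {k} → (Fin k → ℕ) → Set
PermOf {k} α = (i : Fin k) → Permutation′ (α i)

permV : ∀ {k} (α : Fin k → ℕ) → PermOf α → Vtx k → Vtx k
permV α σ (i , j) with j <? α i
... | yes p = (i , toℕ (σ i ⟨$⟩ʳ fromℕ< p))
... | no _  = (i , j)

permE : ∀ {k} (α : Fin k → ℕ) → PermOf α → Edge k → Edge k
permE α σ (u , v) = (permV α σ u , permV α σ v)

permG : ∀ {k} (α : Fin k → ℕ) → PermOf α → Graph k → Graph k
permG α σ G = graph (size G) (map (permE α σ) (edges G))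

liftV : ∀ {k} → Vtx k → Vtx (suc k)
liftV (i , j) = (inject₁ i , j)

liftE : ∀ {k} → Edge k → Edge (suc k)
liftE (u , v) = (liftV u , liftV v)

extPermV : ∀ {k} (α : Fin k → ℕ) → PermOf α → Vtx (suc k) → Vtx (suc k)
extPermV {k} α σ (i , j) with toℕ i <? k
... | yes p = liftV (permV α σ (fromℕ< p , j))
... | no _  = (i , j)

extPermG : ∀ {k} (α : Fin k → ℕ) → PermOf α → Graph (suc k) → Graph (suc k)
extPermG α σ G = graph (size G) (map (λ e → (extPermV α σ (proj₁ e) , extPermV α σ (proj₂ e))) (edges G))

_⊎E_ : ∀ {k} → Graph k → List (Edge k) → Graph k
G ⊎E es = graph (size G) (edges G ++ es)

-- all lists of length n over Fin N (colourings with colours 0..N-1,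
-- listed in the order of `verts`)
allLists : (N n : ℕ) → List (List (Fin N))
allLists N zero    = [] ∷ []
allLists N (suc n) = concatMap (λ c → map (c ∷_) (allLists N n)) (allFin N)

colorOf : ∀ {k N} → List (Vtx k × Fin N) → Vtx k → Maybe (Fin N)
colorOf [] u = nothing
colorOf ((v , c) ∷ xs) u with v ≟V u
... | yes _ = just c
... | no _  = colorOf xs u

-- κ is a proper colouring of G whose monomial ∏_v x_{κ(v)}^{w(v)} is
-- ∏_{c<N, i<k} ((x_{c+1})_{i+1})^{e c i}
GoodColouring : ∀ {k} (N : ℕ) (e : Fin N → Fin k → ℕ) (G : Graph k) → List (Fin N) → Set
GoodColouring N e G κ =
  All (λ ed → colorOf (zip (verts (size G)) κ) (proj₁ ed) ≢ colorOf (zip (verts (size G)) κ) (proj₂ ed)) (edges G)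
  × (∀ c i → length (filter (λ p → (proj₁ (proj₁ p) Fin.≟ i) ×-dec (proj₂ p Fin.≟ c)) (zip (verts (size G)) κ)) ≡ e c i)

goodColouring? : ∀ {k} (N : ℕ) (e : Fin N → Fin k → ℕ) (G : Graph k) (κ : List (Fin N)) → Dec (GoodColouring N e G κ)
goodColouring? N e G κ =
  All.all? (λ ed → ¬? (maybe-≡-dec Fin._≟_ (colorOf (zip (verts (size G)) κ) (proj₁ ed)) (colorOf (zip (verts (size G)) κ) (proj₂ ed)))) (edges G)
  ×-dec all? (λ c → all? (λ i → length (filter (λ p → (proj₁ (proj₁ p) Fin.≟ i) ×-dec (proj₂ p Fin.≟ c)) (zip (verts (size G)) κ)) ℕ.≟ e c i))

-- coefficient of the monomial ∏_{c<N,i<k} ((x_{c+1})_{i+1})^{e c i} in X_k(G)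
-- (every monomial arises this way for N large enough, and all proper
-- colourings producing it take values in the first N colours)
coeffX : ∀ {k} (N : ℕ) (e : Fin N → Fin k → ℕ) → Graph k → ℕ
coeffX N e G = length (filter (goodColouring? N e G) (allLists N (length (verts (size G)))))

δ : ∀ {k} → Fin k → Fin k → ℕ
δ m n with m Fin.≟ n
... | yes _ = 1
... | no _  = 0

module WithRing {a ℓ : Level} (R : CommutativeRing a ℓ) where
  open CommutativeRing R

  Comb : ℕ → Set a
  Comb k = List (Carrier × Graph k)

  coeff : ∀ {k} → Comb k → Graph k → Carrier
  coeff [] G = 0#
  coeff ((r , H) ∷ L) G with sameGraph? H G
  ... | yes _ = r + coeff L G
  ... | no _  = coeff L G

  _≈Γ_ : ∀ {k} → Comb k → Comb k → Set ℓ
  L ≈Γ L′ = ∀ G → WF G → coeff L G ≈ coeff L′ G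

  scale : ∀ {k} → Carrier → Comb k → Comb k
  scale r = map (λ p → (r * proj₁ p , proj₂ p))

  lincomb : ∀ {k} → List (Carrier × Comb k) → Comb k
  lincomb = foldr (λ p acc → scale (proj₁ p) (proj₂ p) ++ acc) []

  InSpan : ∀ {k} {t} → (Comb k → Set t) → Comb k → Set (a ⊔ ℓ ⊔ t)
  InSpan {k} T L = Σ (List (Carrier × Comb k)) λ ts → All (λ p → T (proj₂ p)) ts × (L ≈Γ lincomb ts)

  natR : ℕ → Carrier
  natR zero    = 0#
  natR (suc n) = 1# + natR n

  XCoeff : ∀ {k} (N : ℕ) (e : Fin N → Fin k → ℕ) → Comb k → Carrier
  XCoeff N e []            = 0#
  XCoeff N e ((r , H) ∷ L) = r * natR (coeffX N e H) + XCoeff N e L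

  InKer : ∀ {k} → Comb k → Set ℓ
  InKer {k} L = ∀ (N : ℕ) (e : Fin N → Fin k → ℕ) → XCoeff N e L ≈ 0#

  ℓiso : ∀ {k} (α : Fin k → ℕ) → PermOf α → Graph k → Comb k
  ℓiso α σ G = (1# , G) ∷ (- 1# , permG α σ G) ∷ []

  Tiso : ∀ {k} → Comb k → Set a
  Tiso {k} L = Σ (Graph k) λ G → WF G × Σ (PermOf (size G)) λ σ → L ≡ ℓiso (size G) σ G

  TisoS : ∀ {k} (α : Fin k → ℕ) → (PermOf α → Set) → Comb k → Set a
  TisoS {k} α S L = Σ (Graph k) λ G → WF G × (∀ i → size G i ≡ α i)
    × Σ (PermOf α) λ σ → S σ × L ≡ ℓiso α σ G

  ℓosExt : ∀ {k} → Fin k × Fin k × Fin k → Graph k → Comb k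
  ℓosExt (m , n , p) G =
      (1# , G ⊎E ((at , bt) ∷ (at , ct) ∷ (bt , ct) ∷ []))
    ∷ (- 1# , G ⊎E ((at , ct) ∷ (bt , ct) ∷ []))
    ∷ (- 1# , G ⊎E ((at , bt) ∷ (bt , ct) ∷ []))
    ∷ (1# , G ⊎E ((bt , ct) ∷ []))
    ∷ []
    where
    at = (m , 0)
    bt = (n , δ m n)
    ct = (p , δ m p ℕ.+ δ n p)

  Tos : ∀ {k} → Comb k → Set a
  Tos {k} L = Σ (Fin k × Fin k × Fin k) λ t → Σ (Graph k) λ G → WF G
    × InRange (size G) (proj₁ t , 0)
    × InRange (size G) (proj₁ (proj₂ t) , δ (proj₁ t) (proj₁ (proj₂ t)))
    × InRange (size G) (proj₂ (proj₂ t) , δ (proj₁ t) (proj₂ (proj₂ t)) ℕ.+ δ (proj₁ (proj₂ t)) (proj₂ (proj₂ t)))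
    × L ≡ ℓosExt t G

  Sufficient : ∀ {k} (α : Fin k → ℕ) → (PermOf α → Set) → Comb k → Set (a ⊔ ℓ)
  Sufficient {k} α S L = Σ (Comb k) λ I → Σ (Comb k) λ O →
    InSpan (TisoS α S) I × InSpan Tos O × (L ≈Γ (I ++ O))

  Lift : ∀ {k} → Comb k → Graph (suc k) → Comb (suc k)
  Lift L H* = map (λ p → (proj₁ p , H* ⊎E map liftE (edges (proj₂ p)))) L

-- Fix a monomial. Its coefficient in X_{k+1}(Lift(G; H*)) is a graph invariant φ(G) of G, and its
-- coefficient in X_{k+1}(Lift(L; H*)) is the linear extension of φ evaluated at L. Because φ respects
-- equality of labelled graphs, this value can be computed from any kernel-form presentation L = I + O,
-- so it suffices that φ kills the generators. For ℓ_iso(G, σ) with σ ∈ S, the relabelling σ′ fixes H*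
-- and carries Lift(G) to Lift(G_σ), and X is invariant under label-preserving relabelling. For
-- Ext(ℓ_os(t); G) the four lifted graphs share the edge b_t c_t and differ in the edges a_t b_t, a_t c_t;
-- a colouring proper on b_t c_t colours a_t differently from b_t or from c_t, so inclusion–exclusion
-- over the proper colourings makes the alternating sum vanish.

module Submission where

open import Defs
open import Level using (Level)
open import Function using (_∘_; _⇔_; mk⇔; Equivalence)
open import Data.Nat as ℕ using (ℕ; zero; suc; _≤_; _<_; _<?_; z≤n; s≤s)
open import Data.Nat.Properties as ℕP using (+-suc; suc-injective; m≤n⇒m≤1+n)
open import Data.Fin as Fin using (Fin; toℕ; fromℕ<; inject₁)
open import Data.Fin.Properties using (toℕ-fromℕ<; fromℕ<-toℕ; toℕ<n; toℕ-inject₁; toℕ-injective; inject₁ℕ<)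
open import Data.Fin.Permutation using (_⟨$⟩ʳ_; flip; inverseˡ; inverseʳ)
open import Data.Product using (∃; _×_; _,_; proj₁; proj₂; swap; uncurry)
open import Data.Sum as Sum using (_⊎_; inj₁; inj₂; [_,_])
open import Data.Maybe using (Maybe; just; nothing; fromMaybe)
open import Data.Maybe.Properties using (just-injective) renaming (≡-dec to maybe-≡-dec)
open import Data.List using (List; []; _∷_; _++_; map; filter; length; concatMap; allFin; upTo; zip)
open import Data.List.Properties
  using (length-map; map-++; map-∘; map-cong; concatMap-cong; zipWith-zeroʳ; filter-some; filter-none)
open import Data.List.Relation.Unary.All as All using (All; []; _∷_)
import Data.List.Relation.Unary.All.Properties as All
open import Data.List.Relation.Unary.All.Properties using (¬Any⇒All¬)
open import Data.List.Relation.Unary.Any as Any using (Any; here; there)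
open import Data.List.Relation.Unary.AllPairs using ([]; _∷_)
open import Data.List.Relation.Unary.Unique.Propositional using (Unique)
import Data.List.Relation.Unary.Unique.Propositional.Properties as Unique
open import Data.List.Membership.Propositional using (_∈_; _∉_; find)
open import Data.List.Membership.Propositional.Properties
  using (∈-allFin; ∈-map⁺; ∈-map⁻; ∈-concatMap⁺; ∈-concatMap⁻; ∈-upTo⁺; ∈-upTo⁻; ∈-++⁺ˡ; ∈-++⁺ʳ)
open import Data.List.Membership.Propositional.Properties.WithK using (unique∧set⇒bag)
open import Data.List.Relation.Binary.BagAndSetEquality using (∼bag⇒↭)
open import Data.List.Relation.Binary.Permutation.Propositional using (_↭_)
open import Data.List.Relation.Binary.Permutation.Propositional.Properties using (↭-length; filter-↭)
open import Data.Empty using (⊥-elim)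
open import Relation.Nullary using (Dec; yes; no; ¬_)
open import Relation.Nullary.Decidable using (_×-dec_; _⊎-dec_; ¬?)
open import Relation.Unary using (Decidable)
open import Relation.Unary.Properties using (_∩?_)
open import Relation.Binary.PropositionalEquality as ≡
  using (_≡_; _≢_; refl; cong; cong₂; sym; trans; subst)
open import Algebra.Bundles using (CommutativeRing)

private
  variable
    A B : Set
    k : ℕ

length-filter-∷-⇔ : {P : A → Set} {Q : B → Set} (P? : Decidable P) (Q? : Decidable Q)
  {x : A} {y : B} {xs : List A} {ys : List B} → P x ⇔ Q y →
  length (filter P? xs) ≡ length (filter Q? ys) → length (filter P? (x ∷ xs)) ≡ length (filter Q? (y ∷ ys))
length-filter-∷-⇔ P? Q? {x} {y} x⇔y eq with P? x | Q? y
... | yes _ | yes _ = cong suc eq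
... | yes p | no ¬q = ⊥-elim (¬q (Equivalence.to x⇔y p))
... | no ¬p | yes q = ⊥-elim (¬p (Equivalence.from x⇔y q))
... | no _  | no _  = eq

module _ {P Q : A → Set} (P? : Decidable P) (Q? : Decidable Q) where

  length-filter-⇔ : (xs : List A) → (∀ {x} → x ∈ xs → P x ⇔ Q x) →
                    length (filter P? xs) ≡ length (filter Q? xs)
  length-filter-⇔ []       _  = refl
  length-filter-⇔ (x ∷ xs) eq = length-filter-∷-⇔ P? Q? (eq (here refl)) (length-filter-⇔ xs (eq ∘ there))

length-filter-map : {P : B → Set} (P? : Decidable P) (f : A → B) (xs : List A) →
                    length (filter P? (map f xs)) ≡ length (filter (P? ∘ f) xs)
length-filter-map P? f []       = refl
length-filter-map P? f (x ∷ xs) with P? (f x)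
... | yes _ = cong suc (length-filter-map P? f xs)
... | no _  = length-filter-map P? f xs

module _ {P X Y : A → Set} (P? : Decidable P) (X? : Decidable X) (Y? : Decidable Y) where

  length-filter-inclusion-exclusion : (xs : List A) → (∀ {x} → x ∈ xs → P x → X x ⊎ Y x) →
    length (filter (P? ∩? (X? ∩? Y?)) xs) ℕ.+ length (filter P? xs)
      ≡ length (filter (P? ∩? Y?) xs) ℕ.+ length (filter (P? ∩? X?) xs)
  length-filter-inclusion-exclusion []       _   = refl
  length-filter-inclusion-exclusion (x ∷ xs) cov
    with P? x | X? x | Y? x | length-filter-inclusion-exclusion xs (cov ∘ there)
  ... | no _  | _     | _     | ih = ih
  ... | yes _ | yes _ | yes _ | ih = cong suc (trans (+-suc _ _) (trans (cong suc ih) (sym (+-suc _ _))))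
  ... | yes _ | yes _ | no _  | ih = trans (+-suc _ _) (trans (cong suc ih) (sym (+-suc _ _)))
  ... | yes _ | no _  | yes _ | ih = trans (+-suc _ _) (cong suc ih)
  ... | yes p | no ¬x | no ¬y | _ with cov (here refl) p
  ...   | inj₁ x = ⊥-elim (¬x x)
  ...   | inj₂ y = ⊥-elim (¬y y)

unique-map : (f : A → B) {xs : List A} → Unique xs →
             (∀ {x y} → x ∈ xs → y ∈ xs → f x ≡ f y → x ≡ y) → Unique (map f xs)
unique-map f {[]}     []       _   = []
unique-map f {x ∷ xs} (x∉ ∷ u) inj =
  All.map⁺ (All.tabulate λ y∈ fx≡fy → All.lookup x∉ y∈ (inj (here refl) (there y∈) fx≡fy))
  ∷ unique-map f u (λ x∈ y∈ → inj (there x∈) (there y∈))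

unique-concatMap : (f : A → List B) {xs : List A} → Unique xs → (∀ x → Unique (f x)) →
                   (∀ {x y z} → z ∈ f x → z ∈ f y → x ≡ y) → Unique (concatMap f xs)
unique-concatMap f {[]}     []       _  _   = []
unique-concatMap f {x ∷ xs} (x∉ ∷ u) uf tag = Unique.++⁺ (uf x) (unique-concatMap f u uf tag) disjoint
  where
  disjoint : ∀ {z} → ¬ (z ∈ f x × z ∈ concatMap f xs)
  disjoint (z∈fx , z∈rest) with find (∈-concatMap⁻ f {xs = xs} z∈rest)
  ... | y , y∈xs , z∈fy = All.lookup x∉ y∈xs (tag z∈fx z∈fy)

module _ {xs : List A} (u : Unique xs) {f g : A → A}
         (f∈ : ∀ {x} → x ∈ xs → f x ∈ xs) (g∈ : ∀ {x} → x ∈ xs → g x ∈ xs)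
         (gf : ∀ {x} → x ∈ xs → g (f x) ≡ x) (fg : ∀ {x} → x ∈ xs → f (g x) ≡ x) where

  map-↭ : map f xs ↭ xs
  map-↭ = ∼bag⇒↭ (unique∧set⇒bag (unique-map f u injective) u (mk⇔ to from))
    where
    injective : ∀ {x y} → x ∈ xs → y ∈ xs → f x ≡ f y → x ≡ y
    injective {x} {y} x∈ y∈ eq = trans (sym (gf x∈)) (trans (cong g eq) (gf y∈))
    to : ∀ {y} → y ∈ map f xs → y ∈ xs
    to y∈ with ∈-map⁻ f y∈
    ... | x , x∈ , refl = f∈ x∈
    from : ∀ {y} → y ∈ xs → y ∈ map f xs
    from y∈ = subst (_∈ map f xs) (fg y∈) (∈-map⁺ f (g∈ y∈))

  length-filter-∘-bijection : {P : A → Set} (P? : Decidable P) →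
                              length (filter (P? ∘ f) xs) ≡ length (filter P? xs)
  length-filter-∘-bijection P? = trans (sym (length-filter-map P? f xs)) (↭-length (filter-↭ P? map-↭))

∈-verts⁺ : (α : Fin k → ℕ) {i : Fin k} {j : ℕ} → j < α i → (i , j) ∈ verts α
∈-verts⁺ α {i} j< =
  ∈-concatMap⁺ (λ i → map (i ,_) (upTo (α i))) (Any.map (λ { refl → ∈-map⁺ (i ,_) (∈-upTo⁺ j<) }) (∈-allFin i))

∈-verts⁻ : (α : Fin k → ℕ) {i : Fin k} {j : ℕ} → (i , j) ∈ verts α → j < α i
∈-verts⁻ {k} α ij∈ with find (∈-concatMap⁻ (λ i → map (i ,_) (upTo (α i))) {xs = allFin k} ij∈)
... | _ , _ , ij∈′ with ∈-map⁻ _ ij∈′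
... | _ , j∈ , refl = ∈-upTo⁻ j∈

verts-unique : (α : Fin k → ℕ) → Unique (verts α)
verts-unique {k} α = unique-concatMap _ (Unique.allFin⁺ k)
  (λ i → unique-map (i ,_) (Unique.upTo⁺ (α i)) (λ _ _ → cong proj₂)) same-label
  where
  same-label : ∀ {i i′ v} → v ∈ map (i ,_) (upTo (α i)) → v ∈ map (i′ ,_) (upTo (α i′)) → i ≡ i′
  same-label v∈ v∈′ with ∈-map⁻ _ v∈ | ∈-map⁻ _ v∈′
  ... | _ , _ , refl | _ , _ , refl = refl

verts-cong : {α β : Fin k → ℕ} → (∀ i → α i ≡ β i) → verts α ≡ verts β
verts-cong {k} α≗β = concatMap-cong (λ i → cong (map (i ,_) ∘ upTo) (α≗β i)) (allFin k)

SameGraph-refl : (G : Graph k) → SameGraph G G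
SameGraph-refl G = (λ _ → refl) , All.tabulate (λ _ → All.tabulate (λ _ → refl))

SameGraph-sym : {G H : Graph k} → SameGraph G H → SameGraph H G
SameGraph-sym (sizes , counts) rewrite verts-cong sizes = (sym ∘ sizes) , All.map (All.map sym) counts

SameGraph-trans : {G H K : Graph k} → SameGraph G H → SameGraph H K → SameGraph G K
SameGraph-trans (sizes , counts) (sizes′ , counts′) rewrite verts-cong sizes =
  (λ i → trans (sizes i) (sizes′ i)) , All.zipWith (All.zipWith (uncurry trans)) (counts , counts′)

-- Colourings, as lists of colours indexed like a vertex list

∈-allLists⁺ : (N : ℕ) (κ : List (Fin N)) → κ ∈ allLists N (length κ)
∈-allLists⁺ N []      = here refl
∈-allLists⁺ N (c ∷ κ) =
  ∈-concatMap⁺ (λ c → map (c ∷_) (allLists N (length κ)))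
    (Any.map (λ { refl → ∈-map⁺ (c ∷_) (∈-allLists⁺ N κ) }) (∈-allFin c))

∈-allLists⁻ : (N n : ℕ) {κ : List (Fin N)} → κ ∈ allLists N n → length κ ≡ n
∈-allLists⁻ N zero    (here refl) = refl
∈-allLists⁻ N (suc n) κ∈ with find (∈-concatMap⁻ (λ c → map (c ∷_) (allLists N n)) {xs = allFin N} κ∈)
... | c , _ , κ∈′ with ∈-map⁻ (c ∷_) κ∈′
... | _ , κ∈″ , refl = cong suc (∈-allLists⁻ N n κ∈″)

allLists-unique : (N n : ℕ) → Unique (allLists N n)
allLists-unique N zero    = [] ∷ []
allLists-unique N (suc n) = unique-concatMap _ (Unique.allFin⁺ N)
  (λ c → unique-map (c ∷_) (allLists-unique N n) (λ _ _ → λ { refl → refl })) same-head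
  where
  same-head : ∀ {c c′ κ} → κ ∈ map (c ∷_) (allLists N n) → κ ∈ map (c′ ∷_) (allLists N n) → c ≡ c′
  same-head κ∈ κ∈′ with ∈-map⁻ _ κ∈ | ∈-map⁻ _ κ∈′
  ... | _ , _ , refl | _ , _ , refl = refl

module _ {N : ℕ} where

  colorOf-here : (w : Vtx k) (x : Fin N) (ps : List (Vtx k × Fin N)) → colorOf ((w , x) ∷ ps) w ≡ just x
  colorOf-here w x ps with w ≟V w
  ... | yes _ = refl
  ... | no w≢w = ⊥-elim (w≢w refl)

  colorOf-there : {w v : Vtx k} (x : Fin N) (ps : List (Vtx k × Fin N)) → w ≢ v →
                  colorOf ((w , x) ∷ ps) v ≡ colorOf ps v
  colorOf-there {w = w} {v} x ps w≢v with w ≟V v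
  ... | yes w≡v = ⊥-elim (w≢v w≡v)
  ... | no _    = refl

  colorOf-∉ : (vs : List (Vtx k)) (κ : List (Fin N)) {v : Vtx k} → v ∉ vs → colorOf (zip vs κ) v ≡ nothing
  colorOf-∉ []       κ       _  = refl
  colorOf-∉ (w ∷ vs) []      _  = refl
  colorOf-∉ (w ∷ vs) (x ∷ κ) {v} v∉ with w ≟V v
  ... | yes refl = ⊥-elim (v∉ (here refl))
  ... | no _     = colorOf-∉ vs κ (v∉ ∘ there)

  colorOf-map : (vs : List (Vtx k)) (g : Vtx k → Fin N) {v : Vtx k} → v ∈ vs →
                colorOf (zip vs (map g vs)) v ≡ just (g v)
  colorOf-map (w ∷ vs) g {v} v∈ with w ≟V v | v∈
  ... | yes refl | _          = refl
  ... | no w≢v   | here refl  = ⊥-elim (w≢v refl)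
  ... | no _     | there v∈′  = colorOf-map vs g v∈′

  colorOf-∈ : (vs : List (Vtx k)) (κ : List (Fin N)) {v : Vtx k} → v ∈ vs → length κ ≡ length vs →
              ∃ λ x → colorOf (zip vs κ) v ≡ just x
  colorOf-∈ (w ∷ vs) (x ∷ κ) {v} v∈ len with w ≟V v | v∈
  ... | yes _  | _         = x , refl
  ... | no w≢v | here refl = ⊥-elim (w≢v refl)
  ... | no _   | there v∈′ = colorOf-∈ vs κ v∈′ (suc-injective len)

  colorOf-injective : (vs : List (Vtx k)) → Unique vs → (κ κ′ : List (Fin N)) →
    length κ ≡ length vs → length κ′ ≡ length vs →
    (∀ {v} → v ∈ vs → colorOf (zip vs κ) v ≡ colorOf (zip vs κ′) v) → κ ≡ κ′
  colorOf-injective []       _        []      []       _   _    _    = refl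
  colorOf-injective (w ∷ vs) (w∉ ∷ u) (x ∷ κ) (x′ ∷ κ′) len len′ same = cong₂ _∷_
    (just-injective (trans (sym (colorOf-here w x (zip vs κ))) (trans (same (here refl)) (colorOf-here w x′ (zip vs κ′)))))
    (colorOf-injective vs u κ κ′ (suc-injective len) (suc-injective len′) λ v∈ →
      trans (sym (colorOf-there x (zip vs κ) (All.lookup w∉ v∈)))
            (trans (same (there v∈)) (colorOf-there x′ (zip vs κ′) (All.lookup w∉ v∈))))

module _ {N : ℕ} (i : Fin k) (c : Fin N) where

  -- The filter of GoodColouring: its count on zip (verts β) κ is the exponent of (x_{c+1})_{i+1}.
  labelColour? : Decidable (λ (p : Vtx k × Fin N) → proj₁ (proj₁ p) ≡ i × proj₂ p ≡ c)
  labelColour? p = (proj₁ (proj₁ p) Fin.≟ i) ×-dec (proj₂ p Fin.≟ c)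

  labelColourOf? : (ps : List (Vtx k × Fin N)) → Decidable (λ v → proj₁ v ≡ i × colorOf ps v ≡ just c)
  labelColourOf? ps v = (proj₁ v Fin.≟ i) ×-dec maybe-≡-dec Fin._≟_ (colorOf ps v) (just c)

  exponent-by-vertices : (vs : List (Vtx k)) → Unique vs → (κ : List (Fin N)) → length κ ≡ length vs →
    length (filter labelColour? (zip vs κ)) ≡ length (filter (labelColourOf? (zip vs κ)) vs)
  exponent-by-vertices []       _        []      _   = refl
  exponent-by-vertices (w ∷ vs) (w∉ ∷ u) (x ∷ κ) len =
    length-filter-∷-⇔ labelColour? (labelColourOf? (zip (w ∷ vs) (x ∷ κ)))
      (mk⇔ (λ (l , e) → l , trans (colorOf-here w x (zip vs κ)) (cong just e))
           (λ (l , e) → l , just-injective (trans (sym (colorOf-here w x (zip vs κ))) e)))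
      (trans (exponent-by-vertices vs u κ (suc-injective len))
        (length-filter-⇔ _ _ vs λ v∈ → let w≢v = All.lookup w∉ v∈ in mk⇔
          (λ (l , e) → l , trans (colorOf-there x (zip vs κ) w≢v) e)
          (λ (l , e) → l , trans (sym (colorOf-there x (zip vs κ) w≢v)) e)))

-- Invariance of coeffX under label-preserving relabelling

Separated : {N : ℕ} (β : Fin k → ℕ) → List (Fin N) → Edge k → Set
Separated β κ e = colorOf (zip (verts β) κ) (proj₁ e) ≢ colorOf (zip (verts β) κ) (proj₂ e)

mapEdge : (Vtx k → Vtx k) → Edge k → Edge k
mapEdge τ e = (τ (proj₁ e) , τ (proj₂ e))

module Relabel (β : Fin k → ℕ) (τ τ⁻¹ : Vtx k → Vtx k)
  (τ⁻¹∘τ : ∀ v → τ⁻¹ (τ v) ≡ v) (τ∘τ⁻¹ : ∀ v → τ (τ⁻¹ v) ≡ v)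
  (τ-verts : ∀ {v} → v ∈ verts β → τ v ∈ verts β)
  (τ⁻¹-verts : ∀ {v} → v ∈ verts β → τ⁻¹ v ∈ verts β)
  (τ-label : ∀ v → proj₁ (τ v) ≡ proj₁ v) where

  private
    vs : List (Vtx k)
    vs = verts β

    vs-unique : Unique vs
    vs-unique = verts-unique β

  τ-∉ : ∀ {v} → v ∉ vs → τ v ∉ vs
  τ-∉ {v} v∉ τv∈ = v∉ (subst (_∈ vs) (τ⁻¹∘τ v) (τ⁻¹-verts τv∈))

  τ⁻¹-∉ : ∀ {v} → v ∉ vs → τ⁻¹ v ∉ vs
  τ⁻¹-∉ {v} v∉ τ⁻¹v∈ = v∉ (subst (_∈ vs) (τ∘τ⁻¹ v) (τ-verts τ⁻¹v∈))

  module _ {N : ℕ} where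

    colour : List (Fin N) → Vtx k → Maybe (Fin N)
    colour κ = colorOf (zip vs κ)

    -- The colouring κ ∘ ρ; the head of κ is a dummy default that is never read.
    pullback : (Vtx k → Vtx k) → List (Fin N) → List (Fin N)
    pullback ρ []          = []
    pullback ρ κ@(x ∷ _)   = map (λ v → fromMaybe x (colour κ (ρ v))) vs

    length-pullback : ∀ ρ (κ : List (Fin N)) → length κ ≡ length vs → length (pullback ρ κ) ≡ length vs
    length-pullback ρ []      len = len
    length-pullback ρ (x ∷ κ) _   = length-map _ vs

    colour-pullback : ∀ ρ → (∀ {v} → v ∈ vs → ρ v ∈ vs) → (∀ {v} → v ∉ vs → ρ v ∉ vs) →
      (κ : List (Fin N)) → length κ ≡ length vs → ∀ u → colour (pullback ρ κ) u ≡ colour κ (ρ u)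
    colour-pullback ρ ρ-∈ ρ-∉ [] len u =
      trans (cong (λ ps → colorOf ps u) nothing-coloured) (cong (λ ps → colorOf ps (ρ u)) (sym nothing-coloured))
      where
      nothing-coloured : zip vs ([] {A = Fin N}) ≡ []
      nothing-coloured = zipWith-zeroʳ _,_ vs
    colour-pullback ρ ρ-∈ ρ-∉ κ@(x ∷ _) len u with Any.any? (u ≟V_) vs
    ... | yes u∈ with colorOf-∈ vs κ (ρ-∈ u∈) len
    ...   | _ , eq = trans (colorOf-map vs _ u∈) (trans (cong (just ∘ fromMaybe x) eq) (sym eq))
    colour-pullback ρ ρ-∈ ρ-∉ κ len u | no u∉ =
      trans (colorOf-∉ vs _ u∉) (sym (colorOf-∉ vs κ (ρ-∉ u∉)))

    colour-pullback-τ : (κ : List (Fin N)) → length κ ≡ length vs →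
                        ∀ u → colour (pullback τ κ) u ≡ colour κ (τ u)
    colour-pullback-τ = colour-pullback τ τ-verts τ-∉

    colour-pullback-τ⁻¹ : (κ : List (Fin N)) → length κ ≡ length vs →
                          ∀ u → colour (pullback τ⁻¹ κ) u ≡ colour κ (τ⁻¹ u)
    colour-pullback-τ⁻¹ = colour-pullback τ⁻¹ τ⁻¹-verts τ⁻¹-∉

    pullback-τ⁻¹-τ : (κ : List (Fin N)) → length κ ≡ length vs → pullback τ⁻¹ (pullback τ κ) ≡ κ
    pullback-τ⁻¹-τ κ len = colorOf-injective vs vs-unique _ κ
      (length-pullback τ⁻¹ (pullback τ κ) (length-pullback τ κ len)) len λ {v} _ →
        trans (colour-pullback-τ⁻¹ (pullback τ κ) (length-pullback τ κ len) v)
              (trans (colour-pullback-τ κ len (τ⁻¹ v)) (cong (colour κ) (τ∘τ⁻¹ v)))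

    pullback-τ-τ⁻¹ : (κ : List (Fin N)) → length κ ≡ length vs → pullback τ (pullback τ⁻¹ κ) ≡ κ
    pullback-τ-τ⁻¹ κ len = colorOf-injective vs vs-unique _ κ
      (length-pullback τ (pullback τ⁻¹ κ) (length-pullback τ⁻¹ κ len)) len λ {v} _ →
        trans (colour-pullback-τ (pullback τ⁻¹ κ) (length-pullback τ⁻¹ κ len) v)
              (trans (colour-pullback-τ⁻¹ κ len (τ v)) (cong (colour κ) (τ⁻¹∘τ v)))

    exponent-pullback : (κ : List (Fin N)) → length κ ≡ length vs → ∀ c i →
      length (filter (labelColour? i c) (zip vs (pullback τ κ))) ≡ length (filter (labelColour? i c) (zip vs κ))
    exponent-pullback κ len c i = begin
      length (filter (labelColour? i c) (zip vs (pullback τ κ)))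
        ≡⟨ exponent-by-vertices i c vs vs-unique _ (length-pullback τ κ len) ⟩
      length (filter (labelColourOf? i c (zip vs (pullback τ κ))) vs)
        ≡⟨ length-filter-⇔ _ _ vs (λ {v} _ → mk⇔
             (λ (l , e) → trans (τ-label v) l , trans (sym (colour-pullback-τ κ len v)) e)
             (λ (l , e) → trans (sym (τ-label v)) l , trans (colour-pullback-τ κ len v) e)) ⟩
      length (filter (labelColourOf? i c (zip vs κ) ∘ τ) vs)
        ≡⟨ length-filter-∘-bijection vs-unique τ-verts τ⁻¹-verts
             (λ {v} _ → τ⁻¹∘τ v) (λ {v} _ → τ∘τ⁻¹ v) _ ⟩
      length (filter (labelColourOf? i c (zip vs κ)) vs)
        ≡⟨ exponent-by-vertices i c vs vs-unique κ len ⟨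
      length (filter (labelColour? i c) (zip vs κ)) ∎
      where open ≡.≡-Reasoning

    separated-pullback : (κ : List (Fin N)) → length κ ≡ length vs → ∀ ed →
                         Separated β (pullback τ κ) ed ⇔ Separated β κ (mapEdge τ ed)
    separated-pullback κ len (u , v) = mk⇔
      (λ ≢ eq → ≢ (trans (colour-pullback-τ κ len u) (trans eq (sym (colour-pullback-τ κ len v)))))
      (λ ≢ eq → ≢ (trans (sym (colour-pullback-τ κ len u)) (trans eq (colour-pullback-τ κ len v))))

    private
      colourings : List (List (Fin N))
      colourings = allLists N (length vs)

      colouring-length : ∀ {κ} → κ ∈ colourings → length κ ≡ length vs
      colouring-length = ∈-allLists⁻ N (length vs)

      ∈-colourings : ∀ {κ} → length κ ≡ length vs → κ ∈ colourings
      ∈-colourings {κ} len = subst (λ n → κ ∈ allLists N n) len (∈-allLists⁺ N κ)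

    module _ (e : Fin N → Fin k → ℕ) (es : List (Edge k)) where

      goodColouring-pullback : (κ : List (Fin N)) → length κ ≡ length vs →
        GoodColouring N e (graph β es) (pullback τ κ) ⇔ GoodColouring N e (graph β (map (mapEdge τ) es)) κ
      goodColouring-pullback κ len = mk⇔
        (λ (proper , monomial) →
          All.map⁺ (All.map (Equivalence.to (separated-pullback κ len _)) proper)
          , λ c i → trans (sym (exponent-pullback κ len c i)) (monomial c i))
        (λ (proper , monomial) →
          All.map (Equivalence.from (separated-pullback κ len _)) (All.map⁻ proper)
          , λ c i → trans (exponent-pullback κ len c i) (monomial c i))

      coeffX-relabel : coeffX N e (graph β es) ≡ coeffX N e (graph β (map (mapEdge τ) es))
      coeffX-relabel = begin
        length (filter (goodColouring? N e (graph β es)) colourings)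
          ≡⟨ length-filter-∘-bijection (allLists-unique N (length vs)) {pullback τ} {pullback τ⁻¹}
               (λ {κ} κ∈ → ∈-colourings (length-pullback τ κ (colouring-length κ∈)))
               (λ {κ} κ∈ → ∈-colourings (length-pullback τ⁻¹ κ (colouring-length κ∈)))
               (λ {κ} κ∈ → pullback-τ⁻¹-τ κ (colouring-length κ∈))
               (λ {κ} κ∈ → pullback-τ-τ⁻¹ κ (colouring-length κ∈)) _ ⟨
        length (filter (goodColouring? N e (graph β es) ∘ pullback τ) colourings)
          ≡⟨ length-filter-⇔ _ _ colourings (λ {κ} κ∈ → goodColouring-pullback κ (colouring-length κ∈)) ⟩
        length (filter (goodColouring? N e (graph β (map (mapEdge τ) es))) colourings) ∎
        where open ≡.≡-Reasoning

-- Proper colourings depend only on the set of unordered edges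

_∈E_ : Edge k → List (Edge k) → Set
e ∈E es = e ∈ es ⊎ swap e ∈ es

_⊆E_ : List (Edge k) → List (Edge k) → Set
es ⊆E es′ = All (_∈E es′) es

_≈E_ : List (Edge k) → List (Edge k) → Set
es ≈E es′ = es ⊆E es′ × es′ ⊆E es

EdgesWithin : List (Vtx k) → List (Edge k) → Set
EdgesWithin vs = All (λ e → proj₁ e ∈ vs × proj₂ e ∈ vs)

joins? : (u v : Vtx k) →
         Decidable (λ (e : Edge k) → (proj₁ e ≡ u × proj₂ e ≡ v) ⊎ (proj₁ e ≡ v × proj₂ e ≡ u))
joins? u v e = ((proj₁ e ≟V u) ×-dec (proj₂ e ≟V v)) ⊎-dec ((proj₁ e ≟V v) ×-dec (proj₂ e ≟V u))

∈⇒countE≢0 : {e : Edge k} {es : List (Edge k)} → e ∈ es → countE (proj₁ e) (proj₂ e) es ≢ 0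
∈⇒countE≢0 {e = e} {es} e∈ count≡0
  with filter-some (joins? (proj₁ e) (proj₂ e)) {es} (Any.map (λ { refl → inj₁ (refl , refl) }) e∈)
... | 0<count rewrite count≡0 = ℕP.<-irrefl refl 0<count

countE≢0⇒∈E : (u v : Vtx k) (es : List (Edge k)) → countE u v es ≢ 0 → (u , v) ∈E es
countE≢0⇒∈E u v es count≢0 with Any.any? (joins? u v) es
... | no ¬joins = ⊥-elim (count≢0 (cong length (filter-none (joins? u v) (¬Any⇒All¬ es ¬joins))))
... | yes joins with find joins
...   | _ , e∈ , inj₁ (refl , refl) = inj₁ e∈
...   | _ , e∈ , inj₂ (refl , refl) = inj₂ e∈

⊆E-by-countE : {vs : List (Vtx k)} {es es′ : List (Edge k)} → EdgesWithin vs es →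
  (∀ {u v} → u ∈ vs → v ∈ vs → countE u v es ≡ countE u v es′) → es ⊆E es′
⊆E-by-countE within same-count = All.tabulate λ {e} e∈ →
  let (u∈ , v∈) = All.lookup within e∈ in
  countE≢0⇒∈E _ _ _ λ count≡0 → ∈⇒countE≢0 e∈ (trans (same-count u∈ v∈) count≡0)

sameGraph⇒≈E : {G G′ : Graph k} → SameGraph G G′ →
  EdgesWithin (verts (size G)) (edges G) → EdgesWithin (verts (size G)) (edges G′) → edges G ≈E edges G′
sameGraph⇒≈E {G = G} {G′} (_ , counts) within within′ =
  ⊆E-by-countE within same-count , ⊆E-by-countE within′ (λ u∈ v∈ → sym (same-count u∈ v∈))
  where
  same-count : ∀ {u v} → u ∈ verts (size G) → v ∈ verts (size G) → countE u v (edges G) ≡ countE u v (edges G′)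
  same-count u∈ v∈ = All.lookup (All.lookup counts u∈) v∈

⊆E-refl : {es : List (Edge k)} → es ⊆E es
⊆E-refl = All.tabulate inj₁

⊆E-++⁺ : {as as′ bs bs′ : List (Edge k)} → as ⊆E as′ → bs ⊆E bs′ → (as ++ bs) ⊆E (as′ ++ bs′)
⊆E-++⁺ {as′ = as′} as⊆ bs⊆ =
  All.++⁺ (All.map (Sum.map ∈-++⁺ˡ ∈-++⁺ˡ) as⊆) (All.map (Sum.map (∈-++⁺ʳ as′) (∈-++⁺ʳ as′)) bs⊆)

⊆E-liftE : {es es′ : List (Edge k)} → es ⊆E es′ → map liftE es ⊆E map liftE es′
⊆E-liftE es⊆ = All.map⁺ (All.map (Sum.map (∈-map⁺ liftE) (∈-map⁺ liftE)) es⊆)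

All-⊆E : {Q : Edge k → Set} → (∀ {e} → Q e → Q (swap e)) →
         {es es′ : List (Edge k)} → es ⊆E es′ → All Q es′ → All Q es
All-⊆E Q-swap es⊆ qs = All.map [ All.lookup qs , Q-swap ∘ All.lookup qs ] es⊆

coeffX-≈E : (N : ℕ) (e : Fin N → Fin k → ℕ) (β : Fin k → ℕ) {es es′ : List (Edge k)} → es ≈E es′ →
            coeffX N e (graph β es) ≡ coeffX N e (graph β es′)
coeffX-≈E N e β {es} {es′} (es⊆ , es′⊆) =
  length-filter-⇔ (goodColouring? N e (graph β es)) (goodColouring? N e (graph β es′))
    (allLists N (length (verts β))) λ _ → mk⇔
  (λ (proper , monomial) → All-⊆E separated-swap es′⊆ proper , monomial)
  (λ (proper , monomial) → All-⊆E separated-swap es⊆ proper , monomial)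
  where
  separated-swap : ∀ {κ : List (Fin N)} {ed} → Separated β κ ed → Separated β κ (swap ed)
  separated-swap ≢ eq = ≢ (sym eq)

_⁻¹ₚ : {α : Fin k → ℕ} → PermOf α → PermOf α
(σ ⁻¹ₚ) i = flip (σ i)

module _ (α : Fin k → ℕ) where

  permV-< : (σ : PermOf α) {i : Fin k} {j : ℕ} (j< : j < α i) →
            permV α σ (i , j) ≡ (i , toℕ (σ i ⟨$⟩ʳ fromℕ< j<))
  permV-< σ {i} {j} j< with j <? α i
  ... | yes _ = refl
  ... | no j≮ = ⊥-elim (j≮ j<)

  permV-≮ : (σ : PermOf α) {i : Fin k} {j : ℕ} → ¬ j < α i → permV α σ (i , j) ≡ (i , j)
  permV-≮ σ {i} {j} j≮ with j <? α i
  ... | yes j< = ⊥-elim (j≮ j<)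
  ... | no _   = refl

  permV-label : (σ : PermOf α) (v : Vtx k) → proj₁ (permV α σ v) ≡ proj₁ v
  permV-label σ (i , j) with j <? α i
  ... | yes _ = refl
  ... | no _  = refl

  permV-InRange : (σ : PermOf α) {v : Vtx k} → InRange α v → InRange α (permV α σ v)
  permV-InRange σ {i , j} j< rewrite permV-< σ j< = toℕ<n _

  permV-cancel : (σ ρ : PermOf α) → (∀ i x → ρ i ⟨$⟩ʳ (σ i ⟨$⟩ʳ x) ≡ x) →
                 ∀ v → permV α ρ (permV α σ v) ≡ v
  permV-cancel σ ρ ρσ≡id (i , j) with j <? α i
  ... | no j≮  = permV-≮ ρ j≮
  ... | yes j< = trans (permV-< ρ (toℕ<n (σ i ⟨$⟩ʳ fromℕ< j<))) (cong (i ,_) (begin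
    toℕ (ρ i ⟨$⟩ʳ fromℕ< (toℕ<n (σ i ⟨$⟩ʳ fromℕ< j<)))
      ≡⟨ cong (toℕ ∘ (ρ i ⟨$⟩ʳ_)) (fromℕ<-toℕ _ _) ⟩
    toℕ (ρ i ⟨$⟩ʳ (σ i ⟨$⟩ʳ fromℕ< j<))
      ≡⟨ cong toℕ (ρσ≡id i _) ⟩
    toℕ (fromℕ< j<)
      ≡⟨ toℕ-fromℕ< j< ⟩
    j ∎))
    where open ≡.≡-Reasoning

  permV-injective : (σ : PermOf α) {u v : Vtx k} → permV α σ u ≡ permV α σ v → u ≡ v
  permV-injective σ {u} {v} eq =
    trans (sym (cancel u)) (trans (cong (permV α (σ ⁻¹ₚ)) eq) (cancel v))
    where
    cancel : ∀ v → permV α (σ ⁻¹ₚ) (permV α σ v) ≡ v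
    cancel = permV-cancel σ (σ ⁻¹ₚ) (λ i _ → inverseˡ (σ i))

  module _ {β : Fin (suc k) → ℕ} (sizes : ∀ i → β (inject₁ i) ≡ α i) where

    liftV-∈-verts : {w : Vtx k} → InRange α w → liftV w ∈ verts β
    liftV-∈-verts {w} w-in = ∈-verts⁺ β (subst (proj₂ w <_) (sym (sizes (proj₁ w))) w-in)

    liftV-∈-verts⁻ : {w : Vtx k} → liftV w ∈ verts β → InRange α w
    liftV-∈-verts⁻ {w} w∈ = subst (proj₂ w <_) (sizes (proj₁ w)) (∈-verts⁻ β w∈)

  extPermV-liftV : (σ : PermOf α) (w : Vtx k) → extPermV α σ (liftV w) ≡ liftV (permV α σ w)
  extPermV-liftV σ (i , j) with toℕ (inject₁ i) <? k
  ... | no i≮k = ⊥-elim (i≮k (inject₁ℕ< i))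
  ... | yes i<k = cong (λ i′ → liftV (permV α σ (i′ , j)))
                       (toℕ-injective (trans (toℕ-fromℕ< i<k) (toℕ-inject₁ i)))

  extPermV-≮ : (σ : PermOf α) {i : Fin (suc k)} {j : ℕ} → ¬ toℕ i < k → extPermV α σ (i , j) ≡ (i , j)
  extPermV-≮ σ {i} i≮k with toℕ i <? k
  ... | yes i<k = ⊥-elim (i≮k i<k)
  ... | no _    = refl

  liftView : (v : Vtx (suc k)) → (∃ λ w → liftV w ≡ v) ⊎ (∀ σ → extPermV α σ v ≡ v)
  liftView (i , j) = view (toℕ i <? k)
    where
    view : Dec (toℕ i < k) → (∃ λ w → liftV w ≡ (i , j)) ⊎ (∀ σ → extPermV α σ (i , j) ≡ (i , j))
    view (yes i<k) = inj₁ ((fromℕ< i<k , j) , cong (_, j) (toℕ-injective (trans (toℕ-inject₁ _) (toℕ-fromℕ< i<k))))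
    view (no i≮k)  = inj₂ λ σ → extPermV-≮ σ i≮k

  extPermV-label : (σ : PermOf α) (v : Vtx (suc k)) → proj₁ (extPermV α σ v) ≡ proj₁ v
  extPermV-label σ v with liftView v
  ... | inj₁ (w , refl) = trans (cong proj₁ (extPermV-liftV σ w)) (cong inject₁ (permV-label σ w))
  ... | inj₂ fixed      = cong proj₁ (fixed σ)

  extPermV-cancel : (σ ρ : PermOf α) → (∀ i x → ρ i ⟨$⟩ʳ (σ i ⟨$⟩ʳ x) ≡ x) →
                    ∀ v → extPermV α ρ (extPermV α σ v) ≡ v
  extPermV-cancel σ ρ ρσ≡id v with liftView v
  ... | inj₁ (w , refl) = trans (cong (extPermV α ρ) (extPermV-liftV σ w))
                                (trans (extPermV-liftV ρ (permV α σ w)) (cong liftV (permV-cancel σ ρ ρσ≡id w)))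
  ... | inj₂ fixed      = trans (cong (extPermV α ρ) (fixed σ)) (fixed ρ)

  extPermV-∈-verts : {β : Fin (suc k) → ℕ} → (∀ i → β (inject₁ i) ≡ α i) →
                     (σ : PermOf α) {v : Vtx (suc k)} → v ∈ verts β → extPermV α σ v ∈ verts β
  extPermV-∈-verts {β} sizes σ {v} v∈ with liftView v
  ... | inj₁ (w , refl) = subst (_∈ verts β) (sym (extPermV-liftV σ w))
                            (liftV-∈-verts sizes (permV-InRange σ (liftV-∈-verts⁻ sizes v∈)))
  ... | inj₂ fixed      = subst (_∈ verts β) (sym (fixed σ)) v∈

WF⇒EdgesWithin : {G : Graph k} → WF G → EdgesWithin (verts (size G)) (edges G)
WF⇒EdgesWithin {G = G} = All.map λ (u-in , v-in , _) → ∈-verts⁺ (size G) u-in , ∈-verts⁺ (size G) v-in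

-- A symmetry σ′ of H* turns ℓ_iso(G, σ) into a relabelling of the lifted graphs

module _ {N : ℕ} (e : Fin N → Fin (suc k) → ℕ) (α : Fin k → ℕ) (σ : PermOf α)
         (H* : Graph (suc k)) (H*-WF : WF H*) (sizes : ∀ i → size H* (inject₁ i) ≡ α i)
         (H*-symmetric : SameGraph H* (extPermG α σ H*)) where

  private
    β : Fin (suc k) → ℕ
    β = size H*

    τ : Vtx (suc k) → Vtx (suc k)
    τ = extPermV α σ

    relabel-commutes-with-lift : (es : List (Edge k)) →
      map (mapEdge τ) (map liftE es) ≡ map liftE (map (permE α σ) es)
    relabel-commutes-with-lift es = trans (sym (map-∘ es))
      (trans (map-cong (λ (u , v) → cong₂ _,_ (extPermV-liftV α σ u) (extPermV-liftV α σ v)) es) (map-∘ es))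

    H*-edges-≈E : edges H* ≈E map (mapEdge τ) (edges H*)
    H*-edges-≈E = sameGraph⇒≈E H*-symmetric (WF⇒EdgesWithin H*-WF)
      (All.map⁺ (All.map (λ (u∈ , v∈) → extPermV-∈-verts α sizes σ u∈ , extPermV-∈-verts α sizes σ v∈)
                         (WF⇒EdgesWithin H*-WF)))

  coeffX-lift-permE : (es : List (Edge k)) →
    coeffX N e (H* ⊎E map liftE es) ≡ coeffX N e (H* ⊎E map liftE (map (permE α σ) es))
  coeffX-lift-permE es = begin
    coeffX N e (graph β (edges H* ++ map liftE es))
      ≡⟨ R.coeffX-relabel e (edges H* ++ map liftE es) ⟩
    coeffX N e (graph β (map (mapEdge τ) (edges H* ++ map liftE es)))
      ≡⟨ cong (coeffX N e ∘ graph β) (trans (map-++ (mapEdge τ) (edges H*) _)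
                                           (cong (map (mapEdge τ) (edges H*) ++_) (relabel-commutes-with-lift es))) ⟩
    coeffX N e (graph β (map (mapEdge τ) (edges H*) ++ map liftE (map (permE α σ) es)))
      ≡⟨ coeffX-≈E N e β (⊆E-++⁺ (proj₂ H*-edges-≈E) ⊆E-refl , ⊆E-++⁺ (proj₁ H*-edges-≈E) ⊆E-refl) ⟩
    coeffX N e (graph β (edges H* ++ map liftE (map (permE α σ) es))) ∎
    where
    open ≡.≡-Reasoning
    module R = Relabel β τ (extPermV α (σ ⁻¹ₚ))
      (extPermV-cancel α σ (σ ⁻¹ₚ) (λ i _ → inverseˡ (σ i)))
      (extPermV-cancel α (σ ⁻¹ₚ) σ (λ i _ → inverseʳ (σ i)))
      (extPermV-∈-verts α sizes σ) (extPermV-∈-verts α sizes (σ ⁻¹ₚ)) (extPermV-label α σ)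

-- Inclusion–exclusion for the lifted terms of Ext(ℓ_os(t); G)

module _ {N : ℕ} (e : Fin N → Fin (suc k) → ℕ) (H* : Graph (suc k)) (base : List (Edge k)) (a b c : Vtx k) where

  private
    β : Fin (suc k) → ℕ
    β = size H*

    Good : List (Edge k) → List (Fin N) → Set
    Good extra = GoodColouring N e (H* ⊎E map liftE (base ++ extra))

    good? : (extra : List (Edge k)) → Decidable (Good extra)
    good? extra = goodColouring? N e (H* ⊎E map liftE (base ++ extra))

    separated? : (ed : Edge k) → Decidable (λ (κ : List (Fin N)) → Separated β κ (liftE ed))
    separated? ed κ = ¬? (maybe-≡-dec Fin._≟_ _ _)

    good-∷ : ∀ ed extra {κ} → Good (ed ∷ extra) κ ⇔ (Separated β κ (liftE ed) × Good extra κ)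
    good-∷ ed extra = mk⇔
      (λ (proper , monomial) → let (old , new) = split proper in All.head new , join old (All.tail new) , monomial)
      (λ (sep , proper , monomial) → let (old , new) = split proper in join old (sep ∷ new) , monomial)
      where
      split : ∀ {Q : Edge (suc k) → Set} {xs} → All Q (edges H* ++ map liftE (base ++ xs)) →
              All Q (edges H* ++ map liftE base) × All Q (map liftE xs)
      split {xs = xs} qs with All.++⁻ (edges H*) qs
      ... | qH , qG rewrite map-++ liftE base xs with All.++⁻ (map liftE base) qG
      ...   | qbase , qxs = All.++⁺ qH qbase , qxs

      join : ∀ {Q : Edge (suc k) → Set} {xs} → All Q (edges H* ++ map liftE base) → All Q (map liftE xs) →
             All Q (edges H* ++ map liftE (base ++ xs))
      join {xs = xs} qs qxs with All.++⁻ (edges H*) qs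
      ... | qH , qbase rewrite map-++ liftE base xs = All.++⁺ qH (All.++⁺ qbase qxs)

    bc : List (Edge k)
    bc = (b , c) ∷ []

    b≠c⇒a≠b∨a≠c : ∀ {κ} → Good bc κ → Separated β κ (liftE (a , b)) ⊎ Separated β κ (liftE (a , c))
    b≠c⇒a≠b∨a≠c {κ} good
      with Equivalence.to (good-∷ (b , c) []) good
         | maybe-≡-dec Fin._≟_ (colorOf (zip (verts β) κ) (liftV a)) (colorOf (zip (verts β) κ) (liftV b))
    ... | b≠c , _ | yes a=b = inj₂ λ a=c → b≠c (trans (sym a=b) a=c)
    ... | _       | no a≠b  = inj₁ a≠b

  coeffX-ℓos : let count = λ extra → coeffX N e (H* ⊎E map liftE (base ++ extra)) in
    count ((a , b) ∷ (a , c) ∷ (b , c) ∷ []) ℕ.+ count ((b , c) ∷ [])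
      ≡ count ((a , c) ∷ (b , c) ∷ []) ℕ.+ count ((a , b) ∷ (b , c) ∷ [])
  coeffX-ℓos = begin
    length (filter (good? ((a , b) ∷ (a , c) ∷ bc)) κs) ℕ.+ length (filter (good? bc) κs)
      ≡⟨ cong (ℕ._+ length (filter (good? bc) κs))
           (length-filter-⇔ (good? ((a , b) ∷ (a , c) ∷ bc))
              (good? bc ∩? (separated? (a , b) ∩? separated? (a , c))) κs λ _ → mk⇔
           (λ g → let (ab , g′) = to (good-∷ _ _) g ; (ac , g″) = to (good-∷ _ _) g′ in g″ , ab , ac)
           (λ (g , ab , ac) → from (good-∷ _ _) (ab , from (good-∷ _ _) (ac , g)))) ⟩
    length (filter (good? bc ∩? (separated? (a , b) ∩? separated? (a , c))) κs) ℕ.+ length (filter (good? bc) κs)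
      ≡⟨ length-filter-inclusion-exclusion (good? bc) (separated? (a , b)) (separated? (a , c)) κs
           (λ _ → b≠c⇒a≠b∨a≠c) ⟩
    length (filter (good? bc ∩? separated? (a , c)) κs) ℕ.+ length (filter (good? bc ∩? separated? (a , b)) κs)
      ≡⟨ cong₂ ℕ._+_
           (length-filter-⇔ (good? ((a , c) ∷ bc)) (good? bc ∩? separated? (a , c)) κs λ _ → swap-⇔ (good-∷ _ _))
           (length-filter-⇔ (good? ((a , b) ∷ bc)) (good? bc ∩? separated? (a , b)) κs λ _ → swap-⇔ (good-∷ _ _)) ⟨
    length (filter (good? ((a , c) ∷ bc)) κs) ℕ.+ length (filter (good? ((a , b) ∷ bc)) κs) ∎
    where
    open ≡.≡-Reasoning
    open Equivalence
    κs : List (List (Fin N))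
    κs = allLists N (length (verts β))
    swap-⇔ : {X Y Z : Set} → X ⇔ (Y × Z) → X ⇔ (Z × Y)
    swap-⇔ X⇔ = mk⇔ (swap ∘ to X⇔) (from X⇔ ∘ swap)

InRange-cong : {α β : Fin k → ℕ} → (∀ i → α i ≡ β i) → {v : Vtx k} → InRange α v → InRange β v
InRange-cong α≗β {v} = subst (proj₂ v <_) (α≗β (proj₁ v))

WF-permG : (α : Fin k → ℕ) (σ : PermOf α) (G : Graph k) → (∀ i → size G i ≡ α i) → WF G → WF (permG α σ G)
WF-permG α σ G sizes =
  All.map⁺ ∘ All.map λ (u-in , v-in , u≢v) → in-range u-in , in-range v-in , u≢v ∘ permV-injective α σ
  where
  in-range : ∀ {u} → InRange (size G) u → InRange (size G) (permV α σ u)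
  in-range = InRange-cong (sym ∘ sizes) ∘ permV-InRange α σ ∘ InRange-cong sizes

δ-refl : (m : Fin k) → δ m m ≡ 1
δ-refl m with m Fin.≟ m
... | yes _   = refl
... | no m≢m  = ⊥-elim (m≢m refl)

-- The second coordinates of a_t, b_t, c_t count the earlier vertices with the same label.
aₜ≢bₜ : (m n : Fin k) → (m , 0) ≢ (n , δ m n)
aₜ≢bₜ m n eq with refl ← cong proj₁ eq with () ← trans (cong proj₂ eq) (δ-refl m)

aₜ≢cₜ : (m n p : Fin k) → (m , 0) ≢ (p , δ m p ℕ.+ δ n p)
aₜ≢cₜ m n p eq with refl ← cong proj₁ eq with () ← trans (cong proj₂ eq) (cong (ℕ._+ δ n m) (δ-refl m))

bₜ≢cₜ : (m n p : Fin k) → (n , δ m n) ≢ (p , δ m p ℕ.+ δ n p)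
bₜ≢cₜ m n p eq with refl ← cong proj₁ eq =
  ℕP.1+n≢n (sym (trans (cong proj₂ eq) (trans (cong (δ m n ℕ.+_) (δ-refl n)) (ℕP.+-comm (δ m n) 1))))

-- Linear functionals on Γ_k induced by graph invariants

module Functional {a ℓ : Level} (R : CommutativeRing a ℓ) where
  open CommutativeRing R renaming (refl to ≈-refl; sym to ≈-sym; trans to ≈-trans)
  open WithRing R
  open import Relation.Binary.Reasoning.Setoid setoid
  open import Algebra.Properties.Ring ring using (-1*x≈-x)
  open import Algebra.Properties.Group +-group using (x∙y⁻¹≈ε⇒x≈y)
  open import Algebra.Properties.AbelianGroup +-abelianGroup using (⁻¹-∙-comm)

  evalΓ : (Graph k → Carrier) → Comb k → Carrier
  evalΓ φ []            = 0#
  evalΓ φ ((r , G) ∷ L) = r * φ G + evalΓ φ L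

  AllWF : Comb k → Set a
  AllWF = All (WF ∘ proj₂)

  evalΓ-++ : (φ : Graph k → Carrier) (L L′ : Comb k) → evalΓ φ (L ++ L′) ≈ evalΓ φ L + evalΓ φ L′
  evalΓ-++ φ []            L′ = ≈-sym (+-identityˡ _)
  evalΓ-++ φ ((r , G) ∷ L) L′ = ≈-trans (+-congˡ (evalΓ-++ φ L L′)) (≈-sym (+-assoc _ _ _))

  evalΓ-scale : (φ : Graph k → Carrier) (r : Carrier) (L : Comb k) → evalΓ φ (scale r L) ≈ r * evalΓ φ L
  evalΓ-scale φ r []            = ≈-sym (zeroʳ r)
  evalΓ-scale φ r ((s , G) ∷ L) = ≈-trans (+-cong (*-assoc r s (φ G)) (evalΓ-scale φ r L)) (≈-sym (distribˡ r _ _))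

  evalΓ-lincomb : (φ : Graph k → Carrier) (ts : List (Carrier × Comb k)) →
                  All (λ t → evalΓ φ (proj₂ t) ≈ 0#) ts → evalΓ φ (lincomb ts) ≈ 0#
  evalΓ-lincomb φ []             []       = ≈-refl
  evalΓ-lincomb φ ((r , L) ∷ ts) (h ∷ hs) = begin
    evalΓ φ (scale r L ++ lincomb ts)         ≈⟨ evalΓ-++ φ (scale r L) (lincomb ts) ⟩
    evalΓ φ (scale r L) + evalΓ φ (lincomb ts) ≈⟨ +-cong (evalΓ-scale φ r L) (evalΓ-lincomb φ ts hs) ⟩
    r * evalΓ φ L + 0#                        ≈⟨ +-identityʳ _ ⟩
    r * evalΓ φ L                             ≈⟨ *-congˡ h ⟩
    r * 0#                                    ≈⟨ zeroʳ r ⟩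
    0#                                        ∎

  AllWF-lincomb : (ts : List (Carrier × Comb k)) → All (AllWF ∘ proj₂) ts → AllWF (lincomb ts)
  AllWF-lincomb []             []       = []
  AllWF-lincomb ((r , L) ∷ ts) (h ∷ hs) = All.++⁺ (All.map⁺ h) (AllWF-lincomb ts hs)

  coeff-++ : (L L′ : Comb k) (G : Graph k) → coeff (L ++ L′) G ≈ coeff L G + coeff L′ G
  coeff-++ []            L′ G = ≈-sym (+-identityˡ _)
  coeff-++ ((r , H) ∷ L) L′ G with sameGraph? H G
  ... | yes _ = ≈-trans (+-congˡ (coeff-++ L L′ G)) (≈-sym (+-assoc _ _ _))
  ... | no _  = coeff-++ L L′ G

  coeff-scale : (r : Carrier) (L : Comb k) (G : Graph k) → coeff (scale r L) G ≈ r * coeff L G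
  coeff-scale r []            G = ≈-sym (zeroʳ r)
  coeff-scale r ((s , H) ∷ L) G with sameGraph? H G
  ... | yes _ = ≈-trans (+-congˡ (coeff-scale r L G)) (≈-sym (distribˡ r s _))
  ... | no _  = coeff-scale r L G

  without : Graph k → Comb k → Comb k
  without G₀ []            = []
  without G₀ ((r , H) ∷ L) with sameGraph? H G₀
  ... | yes _ = without G₀ L
  ... | no _  = (r , H) ∷ without G₀ L

  length-without : (G₀ : Graph k) (L : Comb k) → length (without G₀ L) ≤ length L
  length-without G₀ []            = z≤n
  length-without G₀ ((r , H) ∷ L) with sameGraph? H G₀
  ... | yes _ = m≤n⇒m≤1+n (length-without G₀ L)
  ... | no _  = s≤s (length-without G₀ L)

  length-without-head : (G₀ : Graph k) (r : Carrier) (L : Comb k) → length (without G₀ ((r , G₀) ∷ L)) ≤ length L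
  length-without-head G₀ r L with sameGraph? G₀ G₀
  ... | yes _    = length-without G₀ L
  ... | no G₀≁G₀ = ⊥-elim (G₀≁G₀ (SameGraph-refl G₀))

  AllWF-without : (G₀ : Graph k) (L : Comb k) → AllWF L → AllWF (without G₀ L)
  AllWF-without G₀ []            []       = []
  AllWF-without G₀ ((r , H) ∷ L) (w ∷ ws) with sameGraph? H G₀
  ... | yes _ = AllWF-without G₀ L ws
  ... | no _  = w ∷ AllWF-without G₀ L ws

  coeff-without-same : {G₀ G : Graph k} → SameGraph G₀ G → (L : Comb k) → coeff (without G₀ L) G ≈ 0#
  coeff-without-same G₀~G []            = ≈-refl
  coeff-without-same {G₀ = G₀} {G} G₀~G ((r , H) ∷ L) with sameGraph? H G₀
  ... | yes _    = coeff-without-same G₀~G L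
  ... | no H≁G₀ with sameGraph? H G
  ...   | yes H~G = ⊥-elim (H≁G₀ (SameGraph-trans {G = H} {G} {G₀} H~G (SameGraph-sym {G = G₀} {G} G₀~G)))
  ...   | no _    = coeff-without-same G₀~G L

  coeff-without-other : {G₀ G : Graph k} → ¬ SameGraph G₀ G → (L : Comb k) → coeff (without G₀ L) G ≈ coeff L G
  coeff-without-other G₀≁G []            = ≈-refl
  coeff-without-other {G₀ = G₀} {G} G₀≁G ((r , H) ∷ L) with sameGraph? H G₀
  ... | yes H~G₀ with sameGraph? H G
  ...   | yes H~G = ⊥-elim (G₀≁G (SameGraph-trans {G = G₀} {H} {G} (SameGraph-sym {G = H} {G₀} H~G₀) H~G))
  ...   | no _    = coeff-without-other G₀≁G L
  coeff-without-other {G₀ = G₀} {G} G₀≁G ((r , H) ∷ L) | no _ with sameGraph? H G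
  ...   | yes _   = +-congˡ (coeff-without-other G₀≁G L)
  ...   | no _    = coeff-without-other G₀≁G L

  RespectsSameGraph : (Graph k → Carrier) → Set ℓ
  RespectsSameGraph φ = ∀ {H G} → WF H → WF G → SameGraph H G → φ H ≈ φ G

  module _ (φ : Graph k → Carrier) (φ-resp : RespectsSameGraph φ) where

    evalΓ-without : (G₀ : Graph k) → WF G₀ → (L : Comb k) → AllWF L →
                    evalΓ φ L ≈ coeff L G₀ * φ G₀ + evalΓ φ (without G₀ L)
    evalΓ-without G₀ w₀ []            []       = ≈-sym (≈-trans (+-identityʳ _) (zeroˡ (φ G₀)))
    evalΓ-without G₀ w₀ ((r , H) ∷ L) (w ∷ ws) with sameGraph? H G₀
    ... | yes H~G₀ = begin
      r * φ H + evalΓ φ L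
        ≈⟨ +-cong (*-congˡ (φ-resp w w₀ H~G₀)) (evalΓ-without G₀ w₀ L ws) ⟩
      r * φ G₀ + (coeff L G₀ * φ G₀ + evalΓ φ (without G₀ L))
        ≈⟨ +-assoc _ _ _ ⟨
      (r * φ G₀ + coeff L G₀ * φ G₀) + evalΓ φ (without G₀ L)
        ≈⟨ +-congʳ (distribʳ (φ G₀) r (coeff L G₀)) ⟨
      (r + coeff L G₀) * φ G₀ + evalΓ φ (without G₀ L) ∎
    ... | no _     = begin
      r * φ H + evalΓ φ L                                      ≈⟨ +-congˡ (evalΓ-without G₀ w₀ L ws) ⟩
      r * φ H + (coeff L G₀ * φ G₀ + evalΓ φ (without G₀ L))  ≈⟨ +-assoc _ _ _ ⟨
      (r * φ H + coeff L G₀ * φ G₀) + evalΓ φ (without G₀ L)  ≈⟨ +-congʳ (+-comm _ _) ⟩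
      (coeff L G₀ * φ G₀ + r * φ H) + evalΓ φ (without G₀ L)  ≈⟨ +-assoc _ _ _ ⟩
      coeff L G₀ * φ G₀ + (r * φ H + evalΓ φ (without G₀ L))  ∎

    -- Induction on the length, removing all terms equal to the first graph at each step.
    evalΓ-vanishes-≤ : ∀ n (L : Comb k) → length L ≤ n → AllWF L →
                       (∀ G → WF G → coeff L G ≈ 0#) → evalΓ φ L ≈ 0#
    evalΓ-vanishes-≤ _       []                _         _           _           = ≈-refl
    evalΓ-vanishes-≤ (suc n) L@((r , G₀) ∷ L′) (s≤s len) ws@(w₀ ∷ _) zero-coeffs = begin
      evalΓ φ L                                   ≈⟨ evalΓ-without G₀ w₀ L ws ⟩
      coeff L G₀ * φ G₀ + evalΓ φ (without G₀ L) ≈⟨ +-cong (*-congʳ (zero-coeffs G₀ w₀)) rest-vanishes ⟩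
      0# * φ G₀ + 0#                              ≈⟨ +-identityʳ _ ⟩
      0# * φ G₀                                   ≈⟨ zeroˡ _ ⟩
      0#                                          ∎
      where
      rest-zero : ∀ G → WF G → coeff (without G₀ L) G ≈ 0#
      rest-zero G w with sameGraph? G₀ G
      ... | yes G₀~G = coeff-without-same G₀~G L
      ... | no G₀≁G  = ≈-trans (coeff-without-other G₀≁G L) (zero-coeffs G w)
      rest-vanishes : evalΓ φ (without G₀ L) ≈ 0#
      rest-vanishes = evalΓ-vanishes-≤ n (without G₀ L) (ℕP.≤-trans (length-without-head G₀ r L′) len)
                                         (AllWF-without G₀ L ws) rest-zero

    evalΓ-cong : (L L′ : Comb k) → AllWF L → AllWF L′ → L ≈Γ L′ → evalΓ φ L ≈ evalΓ φ L′
    evalΓ-cong L L′ ws ws′ L≈L′ = x∙y⁻¹≈ε⇒x≈y _ _ (begin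
      evalΓ φ L + - evalΓ φ L′                 ≈⟨ +-congˡ (-1*x≈-x _) ⟨
      evalΓ φ L + - 1# * evalΓ φ L′           ≈⟨ +-congˡ (evalΓ-scale φ (- 1#) L′) ⟨
      evalΓ φ L + evalΓ φ (scale (- 1#) L′)   ≈⟨ evalΓ-++ φ L _ ⟨
      evalΓ φ (L ++ scale (- 1#) L′)          ≈⟨ evalΓ-vanishes-≤ _ (L ++ scale (- 1#) L′) ℕP.≤-refl
                                                   (All.++⁺ ws (All.map⁺ ws′)) difference-zero ⟩
      0#                                       ∎)
      where
      difference-zero : ∀ G → WF G → coeff (L ++ scale (- 1#) L′) G ≈ 0#
      difference-zero G w = begin
        coeff (L ++ scale (- 1#) L′) G        ≈⟨ coeff-++ L _ G ⟩
        coeff L G + coeff (scale (- 1#) L′) G ≈⟨ +-cong (L≈L′ G w) (coeff-scale (- 1#) L′ G) ⟩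
        coeff L′ G + - 1# * coeff L′ G        ≈⟨ +-congˡ (-1*x≈-x _) ⟩
        coeff L′ G + - coeff L′ G             ≈⟨ -‿inverseʳ _ ⟩
        0#                                     ∎

  evalΓ-difference : (φ : Graph k → Carrier) (G G′ : Graph k) → φ G ≈ φ G′ →
                     evalΓ φ ((1# , G) ∷ (- 1# , G′) ∷ []) ≈ 0#
  evalΓ-difference φ G G′ φG≈φG′ = begin
    1# * φ G + (- 1# * φ G′ + 0#) ≈⟨ +-cong (*-identityˡ _) (+-identityʳ _) ⟩
    φ G + - 1# * φ G′             ≈⟨ +-cong φG≈φG′ (-1*x≈-x _) ⟩
    φ G′ + - φ G′                  ≈⟨ -‿inverseʳ _ ⟩
    0#                             ∎

  evalΓ-alternating : (φ : Graph k → Carrier) (G₁ G₂ G₃ G₄ : Graph k) → φ G₁ + φ G₄ ≈ φ G₂ + φ G₃ →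
                      evalΓ φ ((1# , G₁) ∷ (- 1# , G₂) ∷ (- 1# , G₃) ∷ (1# , G₄) ∷ []) ≈ 0#
  evalΓ-alternating φ G₁ G₂ G₃ G₄ balanced = begin
    1# * x₁ + (- 1# * x₂ + (- 1# * x₃ + (1# * x₄ + 0#)))
      ≈⟨ +-cong (*-identityˡ x₁)
           (+-cong (-1*x≈-x x₂) (+-cong (-1*x≈-x x₃) (≈-trans (+-identityʳ _) (*-identityˡ x₄)))) ⟩
    x₁ + (- x₂ + (- x₃ + x₄))     ≈⟨ +-congˡ (+-congˡ (+-comm (- x₃) x₄)) ⟩
    x₁ + (- x₂ + (x₄ + - x₃))     ≈⟨ +-congˡ (+-assoc (- x₂) x₄ (- x₃)) ⟨
    x₁ + ((- x₂ + x₄) + - x₃)     ≈⟨ +-congˡ (+-congʳ (+-comm (- x₂) x₄)) ⟩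
    x₁ + ((x₄ + - x₂) + - x₃)     ≈⟨ +-congˡ (+-assoc x₄ (- x₂) (- x₃)) ⟩
    x₁ + (x₄ + (- x₂ + - x₃))     ≈⟨ +-assoc x₁ x₄ _ ⟨
    (x₁ + x₄) + (- x₂ + - x₃)     ≈⟨ +-cong balanced (⁻¹-∙-comm x₂ x₃) ⟩
    (x₂ + x₃) + - (x₂ + x₃)       ≈⟨ -‿inverseʳ _ ⟩
    0#                            ∎
    where
    x₁ x₂ x₃ x₄ : Carrier
    x₁ = φ G₁
    x₂ = φ G₂
    x₃ = φ G₃
    x₄ = φ G₄

  ≈Γ-++ : {I I′ O O′ : Comb k} → I ≈Γ I′ → O ≈Γ O′ → (I ++ O) ≈Γ (I′ ++ O′)
  ≈Γ-++ {I = I} {I′} {O} {O′} I≈I′ O≈O′ G w = begin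
    coeff (I ++ O) G       ≈⟨ coeff-++ I O G ⟩
    coeff I G + coeff O G   ≈⟨ +-cong (I≈I′ G w) (O≈O′ G w) ⟩
    coeff I′ G + coeff O′ G ≈⟨ coeff-++ I′ O′ G ⟨
    coeff (I′ ++ O′) G     ∎

  natR-+ : ∀ m n → natR (m ℕ.+ n) ≈ natR m + natR n
  natR-+ zero    n = ≈-sym (+-identityˡ _)
  natR-+ (suc m) n = ≈-trans (+-congˡ (natR-+ m n)) (≈-sym (+-assoc _ _ _))

  AllWF-TisoS : (α : Fin k → ℕ) (S : PermOf α → Set) {C : Comb k} → TisoS α S C → AllWF C
  AllWF-TisoS α S (G , w , sizes , σ , _ , refl) = w ∷ WF-permG α σ G sizes w ∷ []

  AllWF-Tos : {C : Comb k} → Tos C → AllWF C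
  AllWF-Tos {k = k} ((m , n , p) , G , w , a-in , b-in , c-in , refl) =
    All.++⁺ w (ab ∷ ac ∷ bc ∷ []) ∷ All.++⁺ w (ac ∷ bc ∷ []) ∷ All.++⁺ w (ab ∷ bc ∷ [])
      ∷ All.++⁺ w (bc ∷ []) ∷ []
    where
    Valid : Edge k → Set
    Valid e = InRange (size G) (proj₁ e) × InRange (size G) (proj₂ e) × proj₁ e ≢ proj₂ e
    ab : Valid ((m , 0) , (n , δ m n))
    ab = a-in , b-in , aₜ≢bₜ m n
    ac : Valid ((m , 0) , (p , δ m p ℕ.+ δ n p))
    ac = a-in , c-in , aₜ≢cₜ m n p
    bc : Valid ((n , δ m n) , (p , δ m p ℕ.+ δ n p))
    bc = b-in , c-in , bₜ≢cₜ m n p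

-- The coefficient of a fixed monomial in X_{k+1}(Lift(G; H*)) as a graph invariant of G

module Lifting {a ℓ : Level} (R : CommutativeRing a ℓ) {α : Fin k → ℕ}
               (H* : Graph (suc k)) (H*-WF : WF H*) (sizes : ∀ i → size H* (inject₁ i) ≡ α i)
               (N : ℕ) (e : Fin N → Fin (suc k) → ℕ) where
  open CommutativeRing R using (Carrier; _≈_; 0#; _+_; _*_; reflexive; setoid)
    renaming (sym to ≈-sym; trans to ≈-trans)
  open WithRing R
  open Functional R

  liftedCoeff : Graph k → Carrier
  liftedCoeff G = natR (coeffX N e (H* ⊎E map liftE (edges G)))

  XCoeff-Lift : (L : Comb k) → XCoeff N e (Lift L H*) ≡ evalΓ liftedCoeff L
  XCoeff-Lift []            = refl
  XCoeff-Lift ((r , G) ∷ L) = cong (r * liftedCoeff G +_) (XCoeff-Lift L)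

  liftedCoeff-resp : RespectsSameGraph liftedCoeff
  liftedCoeff-resp {G} {G′} w w′ G~G′@(sizes′ , _) = reflexive (cong natR (coeffX-≈E N e (size H*)
    (⊆E-++⁺ ⊆E-refl (⊆E-liftE (proj₁ ≈E)) , ⊆E-++⁺ ⊆E-refl (⊆E-liftE (proj₂ ≈E)))))
    where
    ≈E : edges G ≈E edges G′
    ≈E = sameGraph⇒≈E G~G′ (WF⇒EdgesWithin w)
           (subst (λ vs → EdgesWithin vs (edges G′)) (verts-cong (sym ∘ sizes′)) (WF⇒EdgesWithin w′))

  evalΓ-TisoS : (S : PermOf α → Set) → (∀ σ → S σ → SameGraph H* (extPermG α σ H*)) →
                {C : Comb k} → TisoS α S C → evalΓ liftedCoeff C ≈ 0#
  evalΓ-TisoS S symmetric (G , _ , _ , σ , σ∈S , refl) =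
    evalΓ-difference liftedCoeff G (permG α σ G)
      (reflexive (cong natR (coeffX-lift-permE e α σ H* H*-WF sizes (symmetric σ σ∈S) (edges G))))

  evalΓ-Tos : {C : Comb k} → Tos C → evalΓ liftedCoeff C ≈ 0#
  evalΓ-Tos ((m , n , p) , G , _ , _ , _ , _ , refl) = evalΓ-alternating liftedCoeff
    (G ⊎E (ab ∷ ac ∷ bc)) (G ⊎E (ac ∷ bc)) (G ⊎E (ab ∷ bc)) (G ⊎E bc) (begin
    natR (count (ab ∷ ac ∷ bc)) + natR (count bc)   ≈⟨ natR-+ (count (ab ∷ ac ∷ bc)) (count bc) ⟨
    natR (count (ab ∷ ac ∷ bc) ℕ.+ count bc)        ≡⟨ cong natR (coeffX-ℓos e H* (edges G) aₜ bₜ cₜ) ⟩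
    natR (count (ac ∷ bc) ℕ.+ count (ab ∷ bc))      ≈⟨ natR-+ (count (ac ∷ bc)) (count (ab ∷ bc)) ⟩
    natR (count (ac ∷ bc)) + natR (count (ab ∷ bc)) ∎)
    where
    open import Relation.Binary.Reasoning.Setoid setoid
    aₜ bₜ cₜ : Vtx k
    aₜ = (m , 0)
    bₜ = (n , δ m n)
    cₜ = (p , δ m p ℕ.+ δ n p)
    ab ac : Edge k
    ab = (aₜ , bₜ)
    ac = (aₜ , cₜ)
    bc : List (Edge k)
    bc = (bₜ , cₜ) ∷ []
    count : List (Edge k) → ℕ
    count extra = coeffX N e (H* ⊎E map liftE (edges G ++ extra))

theorem5p8 : ∀ {a ℓ : Level} (R : CommutativeRing a ℓ) → let open WithRing R in
    (k : ℕ) → 1 ≤ k →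
    (α : Fin k → ℕ) (L : Comb k) →
    All (λ p → WF (proj₂ p) × (∀ i → size (proj₂ p) i ≡ α i)) L →
    InKer L →
    (S : PermOf α → Set) → Sufficient α S L →
    (H* : Graph (suc k)) → WF H* → (∀ i → size H* (inject₁ i) ≡ α i) →
    (∀ σ → S σ → SameGraph H* (extPermG α σ H*)) →
    InKer (Lift L H*)
theorem5p8 R k _ α L L-graphs _ S (I , O , (ts , ts-iso , I≈ts) , (us , us-os , O≈us) , L≈I++O)
           H* H*-WF sizes H*-symmetric N e = begin
  XCoeff N e (Lift L H*)                      ≡⟨ XCoeff-Lift L ⟩
  evalΓ liftedCoeff L                         ≈⟨ evalΓ-cong liftedCoeff liftedCoeff-resp L M
                                                   (All.map proj₁ L-graphs) M-WF L≈M ⟩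
  evalΓ liftedCoeff (lincomb ts ++ lincomb us) ≈⟨ evalΓ-++ liftedCoeff (lincomb ts) (lincomb us) ⟩
  evalΓ liftedCoeff (lincomb ts) + evalΓ liftedCoeff (lincomb us)
    ≈⟨ +-cong (evalΓ-lincomb liftedCoeff ts (All.map (evalΓ-TisoS S H*-symmetric) ts-iso))
              (evalΓ-lincomb liftedCoeff us (All.map evalΓ-Tos us-os)) ⟩
  0# + 0#                                     ≈⟨ +-identityʳ 0# ⟩
  0#                                          ∎
  where
  open CommutativeRing R using (_+_; 0#; +-cong; +-identityʳ; setoid) renaming (trans to ≈-trans)
  open WithRing R
  open Functional R
  open Lifting R H* H*-WF sizes N e
  open import Relation.Binary.Reasoning.Setoid setoid
  M : Comb k
  M = lincomb ts ++ lincomb us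
  M-WF : AllWF M
  M-WF = All.++⁺ (AllWF-lincomb ts (All.map (AllWF-TisoS α S) ts-iso))
                 (AllWF-lincomb us (All.map AllWF-Tos us-os))
  L≈M : L ≈Γ M
  L≈M G w = ≈-trans (L≈I++O G w) (≈Γ-++ {I = I} {lincomb ts} {O} {lincomb us} I≈ts O≈us G w)
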